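{- Let $d\in\mathbb N$, $\mathbf s=(s_1,\dots,s_d)\in\mathbb N^d$ and $\mathbf a=(a_1,\dots,a_d)\in\mathbb Z_{\ge0}^d$, and put $w=s_1+\dots+s_d$. Define $$\mathfrak z_q[\mathbf w^{\mathbf a}(\mathbf s);t]=\mathbf R^{a_1}\big[\mathbf P^{s_1-a_1}[\mathbf y\,\mathbf R^{a_2}[\mathbf P^{s_2-a_2}[\mathbf y\cdots\mathbf R^{a_d}[\mathbf P^{s_d-a_d}[\mathbf y]]\cdots]]]\big](t).$$ If $a_1+\dots+a_j>0$ for all $j=1,\dots,d$, then $$\zeta_q^{\mathbf a}[\mathbf s]=(1-q)^w\,\mathfrak z_q[\mathbf w^{\mathbf a}(\mathbf s);1],\qquad \mathfrak z_q^{\mathbf a}[\mathbf s]=\mathfrak z_q[\mathbf w^{\mathbf a}(\mathbf s);1].$$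
   Context: Here $q$ is a formal variable (equivalently a complex number with $0<|q|<1$), and for integer vectors $\mathbf t,\mathbf s$ of length $d$, $$\zeta_q^{\mathbf t}[\mathbf s]=\sum_{k_1>\dots>k_d>0}\frac{q^{k_1t_1+\cdots+k_dt_d}}{[k_1]^{s_1}\cdots[k_d]^{s_d}},\quad[k]=\frac{1-q^k}{1-q},\qquad \mathfrak z_q^{\mathbf t}[\mathbf s]=\sum_{k_1>\dots>k_d>0}\frac{q^{k_1t_1+\cdots+k_dt_d}}{(1-q^{k_1})^{s_1}\cdots(1-q^{k_d})^{s_d}}.$$ The operators act on power series $f(t)$ divisible by $t$: $\mathbf P[f](t)=\sum_{k\ge0}f(q^kt)$, $\mathbf R[f](t)=\sum_{k\ge1}f(q^kt)$, $\mathbf D[f](t)=f(t)-f(qt)$; $\mathbf P^m$, $\mathbf R^m$ are $m$-fold composites for $m\ge0$, and $\mathbf P^m:=\mathbf D^{ -m}$ for $m<0$ ($\mathbf D$ is inverse to $\mathbf P$). $\mathbf y$ denotes multiplication by $\mathbf y(t)=\frac{t}{1-t}$. The value at $t=1$ is obtained by substituting $t=1$. -}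

module Defs where

open import Data.Nat as ℕ using (ℕ; zero; suc; _≤_; _<_; _%_; _≡ᵇ_)
open import Data.Integer as ℤ using (ℤ; +_; -[1+_])
open import Data.Vec using (Vec; []; _∷_)
open import Data.Fin using (Fin; zero; suc)
open import Data.Bool using (if_then_else_)
open import Data.Product using (∃-syntax)
open import Relation.Binary.PropositionalEquality using (_≡_)

-- Formal power series in q with integer coefficients: ℤ[[q]]
-- A series is given by its coefficient function (coefficient of q^j).

PS : Set
PS = ℕ → ℤ

Σ< : ℕ → (ℕ → ℤ) → ℤ
Σ< zero    f = + 0
Σ< (suc n) f = Σ< n f ℤ.+ f n

zeroPS : PS
zeroPS _ = + 0

onePS : PS
onePS j = if j ≡ᵇ 0 then + 1 else + 0

qPow : ℕ → PS
qPow k j = if j ≡ᵇ k then + 1 else + 0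

_+ₚ_ : PS → PS → PS
(f +ₚ g) j = f j ℤ.+ g j

_*ₚ_ : PS → PS → PS
(f *ₚ g) n = Σ< (suc n) (λ i → f i ℤ.* g (n ℕ.∸ i))

powₚ : PS → ℕ → PS
powₚ f zero    = onePS
powₚ f (suc n) = f *ₚ powₚ f n

oneMinusQPow : ℕ → PS
oneMinusQPow k j = onePS j ℤ.- qPow k j

-- 1/(1 - q^k) = Σ_{m ≥ 0} q^{k m}, the inverse of 1 - q^k in ℤ[[q]] (k ≥ 1);
-- only used for k ≥ 1 (for k = 0 we put 0, it is never needed).
geom : ℕ → PS
geom zero    j = + 0
geom (suc k) j = if (j % suc k) ≡ᵇ 0 then + 1 else + 0

-- 1/[k] = (1 - q)/(1 - q^k), where [k] = (1 - q^k)/(1 - q)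
invBracket : ℕ → PS
invBracket k = oneMinusQPow 1 *ₚ geom k

-- q-adic convergence: a sequence of series converges to L if every
-- coefficient is eventually constant, equal to the coefficient of L.

ConvergesTo : (ℕ → PS) → PS → Set
ConvergesTo seq L = ∀ N → ∃[ M ] (∀ M' → M ≤ M' → seq M' N ≡ L N)

-- Power series in t with coefficients in ℤ[[q]]:  f(t) = Σ_n f n · t^n.

TS : Set
TS = ℕ → PS

oneTS : TS
oneTS n = if n ≡ᵇ 0 then onePS else zeroPS

-- y(t) = t/(1-t) = Σ_{n ≥ 1} t^n
yTS : TS
yTS n = if n ≡ᵇ 0 then zeroPS else onePS

_*ₜ_ : TS → TS → TS
(f *ₜ g) n j = Σ< (suc n) (λ m → (f m *ₚ g (n ℕ.∸ m)) j)

-- Operators, acting on coefficients of t^n (for f divisible by t):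
--   P[f](t) = Σ_{k≥0} f(q^k t)  :  t^n ↦ t^n / (1 - q^n)
--   R[f](t) = Σ_{k≥1} f(q^k t)  :  t^n ↦ q^n t^n / (1 - q^n)
--   D[f](t) = f(t) - f(qt)      :  t^n ↦ (1 - q^n) t^n
Pop : TS → TS
Pop f n = geom n *ₚ f n

Rop : TS → TS
Rop f n = (qPow n *ₚ geom n) *ₚ f n

Dop : TS → TS
Dop f n = oneMinusQPow n *ₚ f n

iter : (TS → TS) → ℕ → TS → TS
iter F zero    f = f
iter F (suc m) f = F (iter F m f)

-- P^m for m ∈ ℤ, with P^m = D^{-m} for m < 0
Ppow : ℤ → TS → TS
Ppow (+ m)     = iter Pop m
Ppow -[1+ m ]  = iter Dop (suc m)

Rpow : ℕ → TS → TS
Rpow = iter Rop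

-- The nested operator: for s = (s_1,…,s_d), a = (a_1,…,a_d),
--   nest s a = R^{a_1}[P^{s_1-a_1}[ y · nest (s_2,…) (a_2,…) ]],  nest [] [] = 1,
-- so that nest s a = z_q[w^a(s); t] for d ≥ 1.
nest : ∀ {d} → Vec ℕ d → Vec ℕ d → TS
nest []       []       = oneTS
nest (s ∷ ss) (a ∷ as) = Rpow a (Ppow (+ s ℤ.- + a) (yTS *ₜ nest ss as))

-- partial sums Σ_{n < M} f n (value at t = 1 is the q-adic limit of these)
partialAt1 : TS → ℕ → PS
partialAt1 f M j = Σ< M (λ n → f n j)

-- Multiple sums over k_1 > k_2 > … > k_d > 0, truncated to k_1 < M.

Σ<ₚ : ℕ → (ℕ → PS) → PS
Σ<ₚ M f j = Σ< M (λ i → f i j)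

sumDec : (d : ℕ) → ℕ → (Vec ℕ d → PS) → PS
sumDec zero    M f = f []
sumDec (suc d) M f = Σ<ₚ M (λ k → if k ≡ᵇ 0 then zeroPS else sumDec d k (λ ks → f (k ∷ ks)))

-- summand of 𝔷_q^t[s]:  Π_i q^{k_i t_i} / (1 - q^{k_i})^{s_i}
frakTerm : ∀ {d} → Vec ℕ d → Vec ℕ d → Vec ℕ d → PS
frakTerm []       []       []       = onePS
frakTerm (t ∷ ts) (s ∷ ss) (k ∷ ks) =
  (qPow (k ℕ.* t) *ₚ powₚ (geom k) s) *ₚ frakTerm ts ss ks

-- summand of ζ_q^t[s]:  Π_i q^{k_i t_i} / [k_i]^{s_i}
zetaTerm : ∀ {d} → Vec ℕ d → Vec ℕ d → Vec ℕ d → PS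
zetaTerm []       []       []       = onePS
zetaTerm (t ∷ ts) (s ∷ ss) (k ∷ ks) =
  (qPow (k ℕ.* t) *ₚ powₚ (invBracket k) s) *ₚ zetaTerm ts ss ks

-- prefix sums a_1 + … + a_{j+1}
prefixSum : ∀ {d} → Vec ℕ d → Fin d → ℕ
prefixSum (x ∷ xs) zero    = x
prefixSum (x ∷ xs) (suc j) = x ℕ.+ prefixSum xs j

-- Multiplying by y turns coefficients into partial sums, so by
--     induction on the depth the partial sums of the nested series at t = 1 are the
--     truncated sums Σ_{M > k₁ > … > k_d > 0} of the 𝔷-summands (nest-coeff); and every
--     ζ-summand is (1 - q)^w times the 𝔷-summand, as 1/[k] = (1 - q)/(1 - q^k).
-- (3) Convergence. Positive prefix sums give a tail estimate (the terms with k₁ = M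
--     have q-order ≥ M), so the truncated 𝔷-sums stabilize; the other two sequences
--     then converge by (2) and continuity of multiplication.

module Submission where

open import Defs
open import Level using (0ℓ)
open import Data.Nat as ℕ using (ℕ; zero; suc; _≤_; _<_; z≤n; s≤s)
import Data.Nat.Properties as ℕP
import Data.Nat.DivMod as DM
open import Data.Integer as ℤ using (ℤ; +_; -[1+_])
import Data.Integer.Properties as ℤP
open import Data.Vec using (Vec; []; _∷_; lookup; sum)
open import Data.Fin using (zero; suc)
open import Data.Product using (Σ-syntax; _×_; _,_; ∃-syntax)
open import Data.Sum using (inj₁; inj₂)
open import Data.Bool using (true; false; T; if_then_else_)
open import Data.Unit using (tt)
open import Relation.Nullary using (yes; no)
open import Relation.Nullary.Negation using (contradiction)
open import Relation.Binary.PropositionalEquality as ≡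
  using (_≡_; _≢_; ≢-sym; cong; cong₂; subst; module ≡-Reasoning)
open import Relation.Binary.Structures using (IsEquivalence)
import Relation.Binary.Reasoning.Setoid
open import Algebra.Bundles using (CommutativeRing)
open import Algebra.Properties.CommutativeSemigroup ℤP.+-commutativeSemigroup
  using () renaming (interchange to +-interchange)
import Algebra.Solver.CommutativeMonoid

Σ-cong : ∀ n {f g : ℕ → ℤ} → (∀ i → i < n → f i ≡ g i) → Σ< n f ≡ Σ< n g
Σ-cong zero    eq = ≡.refl
Σ-cong (suc n) eq = cong₂ ℤ._+_ (Σ-cong n (λ i i<n → eq i (ℕP.m<n⇒m<1+n i<n))) (eq n ℕP.≤-refl)

Σ-cong′ : ∀ n {f g : ℕ → ℤ} → (∀ i → f i ≡ g i) → Σ< n f ≡ Σ< n g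
Σ-cong′ n eq = Σ-cong n (λ i _ → eq i)

Σ-zero : ∀ n → Σ< n (λ _ → + 0) ≡ + 0
Σ-zero zero    = ≡.refl
Σ-zero (suc n) = cong (ℤ._+ + 0) (Σ-zero n)

Σ-+ : ∀ n (f g : ℕ → ℤ) → Σ< n (λ i → f i ℤ.+ g i) ≡ Σ< n f ℤ.+ Σ< n g
Σ-+ zero    f g = ≡.refl
Σ-+ (suc n) f g = ≡.trans (cong (ℤ._+ (f n ℤ.+ g n)) (Σ-+ n f g))
                          (+-interchange (Σ< n f) (Σ< n g) (f n) (g n))

Σ-neg : ∀ n (f : ℕ → ℤ) → Σ< n (λ i → ℤ.- f i) ≡ ℤ.- Σ< n f
Σ-neg zero    f = ≡.refl
Σ-neg (suc n) f = ≡.trans (cong (ℤ._+ (ℤ.- f n)) (Σ-neg n f))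
                          (≡.sym (ℤP.neg-distrib-+ (Σ< n f) (f n)))

Σ-*ˡ : ∀ n (c : ℤ) (f : ℕ → ℤ) → Σ< n (λ i → c ℤ.* f i) ≡ c ℤ.* Σ< n f
Σ-*ˡ zero    c f = ≡.sym (ℤP.*-zeroʳ c)
Σ-*ˡ (suc n) c f = ≡.trans (cong (ℤ._+ (c ℤ.* f n)) (Σ-*ˡ n c f))
                           (≡.sym (ℤP.*-distribˡ-+ c _ _))

Σ-*ʳ : ∀ n (c : ℤ) (f : ℕ → ℤ) → Σ< n (λ i → f i ℤ.* c) ≡ Σ< n f ℤ.* c
Σ-*ʳ n c f = ≡.trans (Σ-cong′ n (λ i → ℤP.*-comm (f i) c))
                     (≡.trans (Σ-*ˡ n c f) (ℤP.*-comm c _))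

Σ-front : ∀ n (f : ℕ → ℤ) → Σ< (suc n) f ≡ f 0 ℤ.+ Σ< n (λ i → f (suc i))
Σ-front zero    f = ℤP.+-comm (+ 0) (f 0)
Σ-front (suc n) f = ≡.trans (cong (ℤ._+ f (suc n)) (Σ-front n f))
                            (ℤP.+-assoc (f 0) (Σ< n (λ i → f (suc i))) (f (suc n)))

Σ-reverse : ∀ n (f : ℕ → ℤ) → Σ< n f ≡ Σ< n (λ i → f (n ℕ.∸ suc i))
Σ-reverse zero    f = ≡.refl
Σ-reverse (suc n) f = ≡.trans (cong (ℤ._+ f n) (Σ-reverse n f))
  (≡.trans (ℤP.+-comm _ (f n)) (≡.sym (Σ-front n (λ i → f (n ℕ.∸ i)))))

Σ-swap : ∀ m n (F : ℕ → ℕ → ℤ) →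
         Σ< m (λ i → Σ< n (λ l → F i l)) ≡ Σ< n (λ l → Σ< m (λ i → F i l))
Σ-swap zero    n F = ≡.sym (Σ-zero n)
Σ-swap (suc m) n F = ≡.trans (cong (ℤ._+ Σ< n (λ l → F m l)) (Σ-swap m n F))
                             (≡.sym (Σ-+ n _ _))

Σ-triangle : ∀ n (F : ℕ → ℕ → ℤ) →
  Σ< (suc n) (λ i → Σ< (suc i) (λ k → F k i)) ≡
  Σ< (suc n) (λ k → Σ< (suc (n ℕ.∸ k)) (λ l → F k (k ℕ.+ l)))
Σ-triangle zero    F = ≡.refl
Σ-triangle (suc n) F = begin
    Σ< (suc n) (λ i → Σ< (suc i) (λ k → F k i)) ℤ.+ (column ℤ.+ F (suc n) (suc n))
  ≡⟨ cong (ℤ._+ (column ℤ.+ F (suc n) (suc n))) (Σ-triangle n F) ⟩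
    rows n ℤ.+ (column ℤ.+ F (suc n) (suc n))
  ≡⟨ ≡.sym (ℤP.+-assoc (rows n) column _) ⟩
    (rows n ℤ.+ column) ℤ.+ F (suc n) (suc n)
  ≡⟨ cong₂ ℤ._+_ (≡.sym (Σ-+ (suc n) (row n) (λ k → F k (suc n)))) lastRow ⟩
    Σ< (suc n) (λ k → row n k ℤ.+ F k (suc n)) ℤ.+ row (suc n) (suc n)
  ≡⟨ cong (ℤ._+ row (suc n) (suc n)) (Σ-cong (suc n) extendRow) ⟩
    rows (suc n)
  ∎
  where
  open ≡-Reasoning
  row : ℕ → ℕ → ℤ
  row n k = Σ< (suc (n ℕ.∸ k)) (λ l → F k (k ℕ.+ l))
  rows : ℕ → ℤ
  rows n = Σ< (suc n) (row n)
  column : ℤ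
  column = Σ< (suc n) (λ k → F k (suc n))
  lastRow : F (suc n) (suc n) ≡ row (suc n) (suc n)
  lastRow rewrite ℕP.n∸n≡0 n | ℕP.+-identityʳ n = ≡.sym (ℤP.+-identityˡ _)
  extendRow : ∀ k → k < suc n → row n k ℤ.+ F k (suc n) ≡ row (suc n) k
  extendRow k (s≤s k≤n) rewrite ℕP.+-∸-assoc 1 k≤n =
    cong (λ x → row n k ℤ.+ F k x)
      (≡.sym (≡.trans (ℕP.+-suc k (n ℕ.∸ k)) (cong suc (ℕP.m+[n∸m]≡n k≤n))))

infix 4 _≐_ _≈_
_≐_ : PS → PS → Set
f ≐ g = ∀ j → f j ≡ g j

-- The same relation wrapped in a record, so that both series can be inferred
-- from an equality proof; this is the setoid equality of the ring ℤ[[q]] below.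
record _≈_ (f g : PS) : Set where
  constructor coeffwise
  field coeff : f ≐ g
open _≈_

negₚ : PS → PS
negₚ f j = ℤ.- f j

*ₚ-cong : ∀ {f f′ g g′} → f ≐ f′ → g ≐ g′ → (f *ₚ g) ≐ (f′ *ₚ g′)
*ₚ-cong f≐f′ g≐g′ n = Σ-cong′ (suc n) (λ i → cong₂ ℤ._*_ (f≐f′ i) (g≐g′ (n ℕ.∸ i)))

*ₚ-comm : ∀ f g → (f *ₚ g) ≐ (g *ₚ f)
*ₚ-comm f g n = ≡.trans (Σ-reverse (suc n) _) (Σ-cong (suc n) swapFactors)
  where
  swapFactors : ∀ i → i < suc n → f (n ℕ.∸ i) ℤ.* g (n ℕ.∸ (n ℕ.∸ i)) ≡ g i ℤ.* f (n ℕ.∸ i)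
  swapFactors i (s≤s i≤n) rewrite ℕP.m∸[m∸n]≡n i≤n = ℤP.*-comm (f (n ℕ.∸ i)) (g i)

*ₚ-assoc : ∀ f g h → ((f *ₚ g) *ₚ h) ≐ (f *ₚ (g *ₚ h))
*ₚ-assoc f g h n =
  ≡.trans (Σ-cong′ (suc n) (λ i → ≡.sym (Σ-*ʳ (suc i) (h (n ℕ.∸ i)) (λ k → f k ℤ.* g (i ℕ.∸ k)))))
  (≡.trans (Σ-triangle n (λ k i → f k ℤ.* g (i ℕ.∸ k) ℤ.* h (n ℕ.∸ i)))
  (Σ-cong′ (suc n) (λ k → ≡.trans (Σ-cong′ (suc (n ℕ.∸ k)) (reindex k))
     (Σ-*ˡ (suc (n ℕ.∸ k)) (f k) (λ l → g l ℤ.* h (n ℕ.∸ k ℕ.∸ l))))))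
  where
  reindex : ∀ k l → f k ℤ.* g (k ℕ.+ l ℕ.∸ k) ℤ.* h (n ℕ.∸ (k ℕ.+ l))
                    ≡ f k ℤ.* (g l ℤ.* h (n ℕ.∸ k ℕ.∸ l))
  reindex k l rewrite ℕP.m+n∸m≡n k l | ≡.sym (ℕP.∸-+-assoc n k l) =
    ℤP.*-assoc (f k) (g l) (h (n ℕ.∸ k ℕ.∸ l))

*ₚ-identityˡ : ∀ f → (onePS *ₚ f) ≐ f
*ₚ-identityˡ f n = ≡.trans (Σ-front n _)
  (≡.trans (cong₂ ℤ._+_ (ℤP.*-identityˡ (f n))
                        (≡.trans (Σ-cong′ n (λ i → ℤP.*-zeroˡ (f (n ℕ.∸ suc i)))) (Σ-zero n)))
           (ℤP.+-identityʳ (f n)))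

*ₚ-distribˡ : ∀ f g h → (f *ₚ (g +ₚ h)) ≐ ((f *ₚ g) +ₚ (f *ₚ h))
*ₚ-distribˡ f g h n =
  ≡.trans (Σ-cong′ (suc n) (λ i → ℤP.*-distribˡ-+ (f i) _ _)) (Σ-+ (suc n) _ _)

ℤ[[q]] : CommutativeRing 0ℓ 0ℓ
ℤ[[q]] = record
  { Carrier = PS ; _≈_ = _≈_ ; _+_ = _+ₚ_ ; _*_ = _*ₚ_ ; -_ = negₚ ; 0# = zeroPS ; 1# = onePS
  ; isCommutativeRing = record
    { isRing = record
      { +-isAbelianGroup = record
        { isGroup = record
          { isMonoid = record
            { isSemigroup = record
              { isMagma = record
                { isEquivalence = ≈-isEquivalence
                ; ∙-cong = λ p q → coeffwise (λ j → cong₂ ℤ._+_ (coeff p j) (coeff q j)) }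
              ; assoc = λ f g h → coeffwise (λ j → ℤP.+-assoc (f j) (g j) (h j)) }
            ; identity = (λ f → coeffwise (λ j → ℤP.+-identityˡ (f j)))
                       , (λ f → coeffwise (λ j → ℤP.+-identityʳ (f j))) }
          ; inverse = (λ f → coeffwise (λ j → ℤP.+-inverseˡ (f j)))
                    , (λ f → coeffwise (λ j → ℤP.+-inverseʳ (f j)))
          ; ⁻¹-cong = λ p → coeffwise (λ j → cong ℤ.-_ (coeff p j)) }
        ; comm = λ f g → coeffwise (λ j → ℤP.+-comm (f j) (g j)) }
      ; *-cong = λ p q → coeffwise (*ₚ-cong (coeff p) (coeff q))
      ; *-assoc = λ f g h → coeffwise (*ₚ-assoc f g h)
      ; *-identity = (λ f → coeffwise (*ₚ-identityˡ f))
                   , (λ f → coeffwise (λ j → ≡.trans (*ₚ-comm f onePS j) (*ₚ-identityˡ f j)))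
      ; distrib = (λ f g h → coeffwise (*ₚ-distribˡ f g h))
                , (λ f g h → coeffwise (λ j → ≡.trans (*ₚ-comm (g +ₚ h) f j)
                     (≡.trans (*ₚ-distribˡ f g h j) (cong₂ ℤ._+_ (*ₚ-comm f g j) (*ₚ-comm f h j)))))
      }
    ; *-comm = λ f g → coeffwise (*ₚ-comm f g)
    }
  }
  where
  ≈-isEquivalence : IsEquivalence _≈_
  ≈-isEquivalence = record
    { refl  = coeffwise (λ j → ≡.refl)
    ; sym   = λ p → coeffwise (λ j → ≡.sym (coeff p j))
    ; trans = λ p q → coeffwise (λ j → ≡.trans (coeff p j) (coeff q j)) }

-- Ring laws used below. The fixed factor in *-congˡ/*-congʳ is passed explicitly:
-- Agda cannot recover it from an unfolded Cauchy product.
open CommutativeRing ℤ[[q]]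
  using ( setoid; *-cong; *-congˡ; *-congʳ; *-assoc; *-comm; *-identityˡ; *-identityʳ
        ; zeroˡ; zeroʳ; *-commutativeMonoid; *-commutativeSemigroup)
  renaming (refl to ≈-refl; sym to ≈-sym; trans to ≈-trans)
module ≈-Reasoning = Relation.Binary.Reasoning.Setoid setoid
open import Algebra.Properties.CommutativeSemigroup *-commutativeSemigroup
  using () renaming (interchange to *ₚ-interchange)
module ×-Solver = Algebra.Solver.CommutativeMonoid *-commutativeMonoid
open ×-Solver using (_⊕_; _⊜_)

pow-cong : ∀ {f g} n → f ≈ g → powₚ f n ≈ powₚ g n
pow-cong zero    f≈g = ≈-refl
pow-cong (suc n) f≈g = *-cong f≈g (pow-cong n f≈g)

pow-+ : ∀ f m n → powₚ f (m ℕ.+ n) ≈ (powₚ f m *ₚ powₚ f n)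
pow-+ f zero    n = ≈-sym (*-identityˡ (powₚ f n))
pow-+ f (suc m) n = ≈-trans (*-congˡ {f} (pow-+ f m n)) (≈-sym (*-assoc f (powₚ f m) (powₚ f n)))

pow-* : ∀ f g n → powₚ (f *ₚ g) n ≈ (powₚ f n *ₚ powₚ g n)
pow-* f g zero    = ≈-sym (*-identityˡ onePS)
pow-* f g (suc n) = ≈-trans (*-congˡ {f *ₚ g} (pow-* f g n)) (*ₚ-interchange f g (powₚ f n) (powₚ g n))

pow-one : ∀ n → powₚ onePS n ≈ onePS
pow-one zero    = ≈-refl
pow-one (suc n) = ≈-trans (*-identityˡ (powₚ onePS n)) (pow-one n)

qPow-ne : ∀ x j → x ≢ j → qPow x j ≡ + 0
qPow-ne x j x≢j with j ℕ.≡ᵇ x in eq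
... | false = ≡.refl
... | true  = contradiction (≡.sym (ℕP.≡ᵇ⇒≡ j x (subst T (≡.sym eq) tt))) x≢j

qPow-self : ∀ x → qPow x x ≡ + 1
qPow-self zero    = ≡.refl
qPow-self (suc x) = qPow-self x

Σ-qPow-outside : ∀ n x (g : ℕ → ℤ) → n ≤ x → Σ< n (λ i → qPow x i ℤ.* g i) ≡ + 0
Σ-qPow-outside zero    x g _    = ≡.refl
Σ-qPow-outside (suc n) x g n<x = cong₂ ℤ._+_
  (Σ-qPow-outside n x g (ℕP.<⇒≤ n<x))
  (≡.trans (cong (ℤ._* g n) (qPow-ne x n (≢-sym (ℕP.<⇒≢ n<x)))) (ℤP.*-zeroˡ (g n)))

Σ-qPow-inside : ∀ n x (g : ℕ → ℤ) → x < n → Σ< n (λ i → qPow x i ℤ.* g i) ≡ g x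
Σ-qPow-inside (suc n) x g x<1+n with ℕP.m<1+n⇒m<n∨m≡n x<1+n
... | inj₁ x<n = ≡.trans (cong₂ ℤ._+_ (Σ-qPow-inside n x g x<n)
                            (≡.trans (cong (ℤ._* g n) (qPow-ne x n (ℕP.<⇒≢ x<n))) (ℤP.*-zeroˡ (g n))))
                         (ℤP.+-identityʳ (g x))
... | inj₂ ≡.refl = ≡.trans (cong₂ ℤ._+_ (Σ-qPow-outside n n g ℕP.≤-refl) (cong (ℤ._* g n) (qPow-self n)))
                            (≡.trans (ℤP.+-identityˡ _) (ℤP.*-identityˡ (g n)))

qPow-shift : ∀ x f j → x ≤ j → (qPow x *ₚ f) j ≡ f (j ℕ.∸ x)
qPow-shift x f j x≤j = Σ-qPow-inside (suc j) x (λ i → f (j ℕ.∸ i)) (s≤s x≤j)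

qPow-shift-low : ∀ x f j → j < x → (qPow x *ₚ f) j ≡ + 0
qPow-shift-low x f j j<x = Σ-qPow-outside (suc j) x (λ i → f (j ℕ.∸ i)) j<x

qPow-+ : ∀ x y → (qPow x *ₚ qPow y) ≈ qPow (x ℕ.+ y)
qPow-+ x y = coeffwise coeffs
  where
  coeffs : (qPow x *ₚ qPow y) ≐ qPow (x ℕ.+ y)
  coeffs j with x ℕ.≤? j
  ... | no x≰j = ≡.trans (qPow-shift-low x (qPow y) j (ℕP.≰⇒> x≰j))
                   (≡.sym (qPow-ne (x ℕ.+ y) j (λ e → x≰j (subst (x ≤_) e (ℕP.m≤m+n x y)))))
  ... | yes x≤j = ≡.trans (qPow-shift x (qPow y) j x≤j) shifted
    where
    shifted : qPow y (j ℕ.∸ x) ≡ qPow (x ℕ.+ y) j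
    shifted with (x ℕ.+ y) ℕ.≟ j
    ... | yes ≡.refl rewrite ℕP.m+n∸m≡n x y = ≡.trans (qPow-self y) (≡.sym (qPow-self (x ℕ.+ y)))
    ... | no x+y≢j = ≡.trans
            (qPow-ne y (j ℕ.∸ x) (λ e → x+y≢j (≡.trans (cong (x ℕ.+_) e) (ℕP.m+[n∸m]≡n x≤j))))
            (≡.sym (qPow-ne (x ℕ.+ y) j x+y≢j))

qPow-pow : ∀ n a → powₚ (qPow n) a ≈ qPow (n ℕ.* a)
qPow-pow n zero    rewrite ℕP.*-zeroʳ n = ≈-refl
qPow-pow n (suc a) rewrite ℕP.*-suc n a =
  ≈-trans (*-congˡ {qPow n} (qPow-pow n a)) (qPow-+ n (n ℕ.* a))

oneMinusQPow-* : ∀ n g j → (oneMinusQPow n *ₚ g) j ≡ g j ℤ.- (qPow n *ₚ g) j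
oneMinusQPow-* n g j =
  ≡.trans (Σ-cong′ (suc j) (λ i →
            ≡.trans (ℤP.*-distribʳ-+ (g (j ℕ.∸ i)) (onePS i) (ℤ.- qPow n i))
                    (cong (λ x → onePS i ℤ.* g (j ℕ.∸ i) ℤ.+ x) (≡.sym (ℤP.neg-distribˡ-* (qPow n i) (g (j ℕ.∸ i)))))))
  (≡.trans (Σ-+ (suc j) _ _)
           (cong₂ ℤ._+_ (*ₚ-identityˡ g j) (Σ-neg (suc j) _)))

-- geom n = Σ_m q^{nm} is the inverse of 1 - q^n for n ≥ 1: its coefficients are
-- periodic of period n and equal to 1 below n, so (1 - q^n)·geom n has only the constant term.
geom-inverse : ∀ n → .{{_ : ℕ.NonZero n}} → (oneMinusQPow n *ₚ geom n) ≈ onePS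
geom-inverse (suc k) = coeffwise coeffs
  where
  n = suc k
  coeffs : (oneMinusQPow n *ₚ geom n) ≐ onePS
  coeffs j with n ℕ.≤? j
  ... | no n≰j = ≡.trans (oneMinusQPow-* n (geom n) j)
      (≡.trans (cong (λ x → geom n j ℤ.- x) (qPow-shift-low n (geom n) j (ℕP.≰⇒> n≰j)))
      (≡.trans (ℤP.+-identityʳ (geom n j)) below))
    where
    below : geom n j ≡ onePS j
    below rewrite DM.m<n⇒m%n≡m (ℕP.≰⇒> n≰j) = ≡.refl
  ... | yes n≤j@(s≤s _) = ≡.trans (oneMinusQPow-* n (geom n) j)
      (≡.trans (cong₂ ℤ._-_ periodic (qPow-shift n (geom n) j n≤j))
      (ℤP.+-inverseʳ (geom n (j ℕ.∸ n))))
    where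
    periodic : geom n j ≡ geom n (j ℕ.∸ n)
    periodic = cong (λ m → if m ℕ.≡ᵇ 0 then + 1 else + 0)
      (≡.trans (cong (ℕ._% n) (≡.sym (ℕP.m∸n+n≡m n≤j))) (DM.[m+n]%n≡m%n (j ℕ.∸ n) n))

geom-pow-inverse : ∀ n → .{{_ : ℕ.NonZero n}} → ∀ e →
                   (powₚ (geom n) e *ₚ powₚ (oneMinusQPow n) e) ≈ onePS
geom-pow-inverse n e = ≈-trans (≈-sym (pow-* (geom n) (oneMinusQPow n) e))
  (≈-trans (pow-cong e (≈-trans (*-comm (geom n) (oneMinusQPow n)) (geom-inverse n))) (pow-one e))

iter-diagonal : (c : ℕ → PS) (F : TS → TS) → (∀ g n → F g n ≈ (c n *ₚ g n)) →
                ∀ m f n → iter F m f n ≈ (powₚ (c n) m *ₚ f n)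
iter-diagonal c F F-diag zero    f n = ≈-sym (*-identityˡ (f n))
iter-diagonal c F F-diag (suc m) f n = ≈-trans (F-diag (iter F m f) n)
  (≈-trans (*-congˡ {c n} (iter-diagonal c F F-diag m f n)) (≈-sym (*-assoc (c n) (powₚ (c n) m) (f n))))

PpowFactor : ℤ → ℕ → PS
PpowFactor (+ m)    n = powₚ (geom n) m
PpowFactor -[1+ m ] n = powₚ (oneMinusQPow n) (suc m)

Ppow-coeff : ∀ x f n → Ppow x f n ≈ (PpowFactor x n *ₚ f n)
Ppow-coeff (+ m)    = iter-diagonal geom Pop (λ g n → ≈-refl) m
Ppow-coeff -[1+ m ] = iter-diagonal oneMinusQPow Dop (λ g n → ≈-refl) (suc m)

Rpow-coeff : ∀ a f n → Rpow a f n ≈ ((qPow (n ℕ.* a) *ₚ powₚ (geom n) a) *ₚ f n)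
Rpow-coeff a f n = ≈-trans (iter-diagonal (λ n → qPow n *ₚ geom n) Rop (λ g n → ≈-refl) a f n)
  (*-congʳ {f n} (≈-trans (pow-* (qPow n) (geom n) a) (*-congʳ {powₚ (geom n) a} (qPow-pow n a))))

+[a+e]-+a : ∀ a e → + (a ℕ.+ e) ℤ.- + a ≡ + e
+[a+e]-+a a e = ≡.trans (ℤP.[+m]-[+n]≡m⊖n (a ℕ.+ e) a)
  (≡.trans (ℤP.⊖-≥ (ℕP.m≤m+n a e)) (cong +_ (ℕP.m+n∸m≡n a e)))

+s-+[1+s+e] : ∀ s e → + s ℤ.- + suc (s ℕ.+ e) ≡ -[1+ e ]
+s-+[1+s+e] s e = ≡.trans (ℤP.[+m]-[+n]≡m⊖n s (suc (s ℕ.+ e)))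
  (≡.trans (ℤP.⊖-< (s≤s (ℕP.m≤m+n s e))) (cong (λ m → ℤ.- + m) 1+s+e∸s≡1+e))
  where
  1+s+e∸s≡1+e : suc (s ℕ.+ e) ℕ.∸ s ≡ suc e
  1+s+e∸s≡1+e = ≡.trans (cong (ℕ._∸ s) (≡.sym (ℕP.+-suc s e))) (ℕP.m+n∸m≡n s (suc e))

-- On t^n with n ≥ 1, the factor of P^{s-a} times 1/(1 - q^n)^a is 1/(1 - q^n)^s,
-- also when s < a, where P^{s-a} = D^{a-s} and the factors (1 - q^n) cancel.
PpowFactor-cancel : ∀ s a n → .{{_ : ℕ.NonZero n}} →
                    (powₚ (geom n) a *ₚ PpowFactor (+ s ℤ.- + a) n) ≈ powₚ (geom n) s
PpowFactor-cancel s a n with ℕP.≤-<-connex a s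
... | inj₁ a≤s with ℕP.m≤n⇒∃[o]m+o≡n a≤s
...   | e , ≡.refl rewrite +[a+e]-+a a e = ≈-sym (pow-+ (geom n) a e)
PpowFactor-cancel s a n | inj₂ s<a with ℕP.m≤n⇒∃[o]m+o≡n s<a
...   | e , ≡.refl rewrite +s-+[1+s+e] s e = begin
    powₚ G (suc (s ℕ.+ e)) *ₚ powₚ O (suc e)
  ≡⟨ cong (λ m → powₚ G m *ₚ powₚ O (suc e)) (≡.sym (ℕP.+-suc s e)) ⟩
    powₚ G (s ℕ.+ suc e) *ₚ powₚ O (suc e)
  ≈⟨ *-congʳ {powₚ O (suc e)} (pow-+ G s (suc e)) ⟩
    (powₚ G s *ₚ powₚ G (suc e)) *ₚ powₚ O (suc e)
  ≈⟨ *-assoc (powₚ G s) (powₚ G (suc e)) (powₚ O (suc e)) ⟩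
    powₚ G s *ₚ (powₚ G (suc e) *ₚ powₚ O (suc e))
  ≈⟨ *-congˡ {powₚ G s} (geom-pow-inverse n (suc e)) ⟩
    powₚ G s *ₚ onePS
  ≈⟨ *-identityʳ (powₚ G s) ⟩
    powₚ G s
  ∎
  where
  open ≈-Reasoning
  G = geom n
  O = oneMinusQPow n

RP-coeff : ∀ s a f n → .{{_ : ℕ.NonZero n}} →
           Rpow a (Ppow (+ s ℤ.- + a) f) n ≈ ((qPow (n ℕ.* a) *ₚ powₚ (geom n) s) *ₚ f n)
RP-coeff s a f n = begin
    Rpow a (Ppow x f) n
  ≈⟨ Rpow-coeff a (Ppow x f) n ⟩
    (Q *ₚ powₚ (geom n) a) *ₚ Ppow x f n
  ≈⟨ *-congˡ {Q *ₚ powₚ (geom n) a} (Ppow-coeff x f n) ⟩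
    (Q *ₚ powₚ (geom n) a) *ₚ (PpowFactor x n *ₚ f n)
  ≈⟨ ≈-sym (*-assoc (Q *ₚ powₚ (geom n) a) (PpowFactor x n) (f n)) ⟩
    ((Q *ₚ powₚ (geom n) a) *ₚ PpowFactor x n) *ₚ f n
  ≈⟨ *-congʳ {f n} (*-assoc Q (powₚ (geom n) a) (PpowFactor x n)) ⟩
    (Q *ₚ (powₚ (geom n) a *ₚ PpowFactor x n)) *ₚ f n
  ≈⟨ *-congʳ {f n} (*-congˡ {Q} (PpowFactor-cancel s a n)) ⟩
    (Q *ₚ powₚ (geom n) s) *ₚ f n
  ∎
  where
  open ≈-Reasoning
  x = + s ℤ.- + a
  Q = qPow (n ℕ.* a)

RP-coeff-zero : ∀ s a f n → f n ≈ zeroPS → Rpow a (Ppow (+ s ℤ.- + a) f) n ≈ zeroPS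
RP-coeff-zero s a f n fₙ≈0 = ≈-trans (Rpow-coeff a (Ppow x f) n)
  (≈-trans (*-congˡ {C} Ppow-vanishes) (zeroʳ C))
  where
  x = + s ℤ.- + a
  C = qPow (n ℕ.* a) *ₚ powₚ (geom n) a
  Ppow-vanishes : Ppow x f n ≈ zeroPS
  Ppow-vanishes = ≈-trans (Ppow-coeff x f n)
    (≈-trans (*-congˡ {PpowFactor x n} fₙ≈0) (zeroʳ (PpowFactor x n)))

Σₚ-cong : ∀ M {f g : ℕ → PS} → (∀ i → f i ≈ g i) → Σ<ₚ M f ≈ Σ<ₚ M g
Σₚ-cong M f≈g = coeffwise (λ j → Σ-cong′ M (λ i → coeff (f≈g i) j))

Σₚ-linear : ∀ M c (f : ℕ → PS) → Σ<ₚ M (λ i → c *ₚ f i) ≈ (c *ₚ Σ<ₚ M f)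
Σₚ-linear M c f = coeffwise (λ j → ≡.trans (Σ-swap M (suc j) (λ i l → c l ℤ.* f i (j ℕ.∸ l)))
  (Σ-cong′ (suc j) (λ l → Σ-*ˡ M (c l) (λ i → f i (j ℕ.∸ l)))))

-- The part of the truncated sum over k₁ > … > k_{d+1} > 0 with first index k₁ = k,
-- so that sumDec (suc d) M f = Σ_{k < M} slice d f k by definition.
slice : ∀ d → (Vec ℕ (suc d) → PS) → ℕ → PS
slice d f k = if k ℕ.≡ᵇ 0 then zeroPS else sumDec d k (λ ks → f (k ∷ ks))

sumDec-cong : ∀ d M {f g : Vec ℕ d → PS} → (∀ ks → f ks ≈ g ks) → sumDec d M f ≈ sumDec d M g
sumDec-cong zero    M f≈g = f≈g []
sumDec-cong (suc d) M {f} {g} f≈g = Σₚ-cong M slices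
  where
  slices : ∀ k → slice d f k ≈ slice d g k
  slices zero    = ≈-refl
  slices (suc k) = sumDec-cong d (suc k) (λ ks → f≈g (suc k ∷ ks))

sumDec-linear : ∀ d M c (f : Vec ℕ d → PS) → sumDec d M (λ ks → c *ₚ f ks) ≈ (c *ₚ sumDec d M f)
sumDec-linear zero    M c f = ≈-refl
sumDec-linear (suc d) M c f = ≈-trans (Σₚ-cong M slices) (Σₚ-linear M c (slice d f))
  where
  slices : ∀ k → slice d (λ ks → c *ₚ f ks) k ≈ (c *ₚ slice d f k)
  slices zero    = ≈-sym (zeroʳ c)
  slices (suc k) = sumDec-linear d (suc k) c (λ ks → f (suc k ∷ ks))

y*-coeff-zero : ∀ f → (yTS *ₜ f) 0 ≈ zeroPS
y*-coeff-zero f = coeffwise (λ j → ≡.trans (ℤP.+-identityˡ _) (coeff (zeroˡ (f 0)) j))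

y*-coeff : ∀ f n → (yTS *ₜ f) n ≈ partialAt1 f n
y*-coeff f n = coeffwise (λ j → ≡.trans (Σ-front n (λ m → (yTS m *ₚ f (n ℕ.∸ m)) j))
  (≡.trans (cong₂ ℤ._+_ (coeff (zeroˡ (f n)) j)
                        (Σ-cong′ n (λ m → coeff (*-identityˡ (f (n ℕ.∸ suc m))) j)))
  (≡.trans (ℤP.+-identityˡ _) (≡.sym (Σ-reverse n (λ m → f m j))))))

partialAt1-one : ∀ K → partialAt1 oneTS (suc K) ≈ onePS
partialAt1-one K = coeffwise (λ j → ≡.trans (Σ-front K (λ m → oneTS m j))
  (≡.trans (cong (λ x → onePS j ℤ.+ x) (Σ-zero K)) (ℤP.+-identityʳ (onePS j))))

mutual
  nest-coeff : ∀ {d} s a (ss as : Vec ℕ d) n →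
    nest (s ∷ ss) (a ∷ as) n ≈ slice d (frakTerm (a ∷ as) (s ∷ ss)) n
  nest-coeff s a ss as zero = RP-coeff-zero s a (yTS *ₜ nest ss as) 0 (y*-coeff-zero (nest ss as))
  nest-coeff {d} s a ss as n@(suc k) = begin
      Rpow a (Ppow (+ s ℤ.- + a) (yTS *ₜ nest ss as)) n
    ≈⟨ RP-coeff s a (yTS *ₜ nest ss as) n ⟩
      C *ₚ (yTS *ₜ nest ss as) n
    ≈⟨ *-congˡ {C} (y*-coeff (nest ss as) n) ⟩
      C *ₚ partialAt1 (nest ss as) n
    ≈⟨ *-congˡ {C} (nest-partialSum ss as k) ⟩
      C *ₚ sumDec d n (frakTerm as ss)
    ≈⟨ ≈-sym (sumDec-linear d n C (frakTerm as ss)) ⟩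
      sumDec d n (λ ks → frakTerm (a ∷ as) (s ∷ ss) (n ∷ ks))
    ∎
    where
    open ≈-Reasoning
    C = qPow (n ℕ.* a) *ₚ powₚ (geom n) s

  nest-partialSum : ∀ {d} (ss as : Vec ℕ d) K →
    partialAt1 (nest ss as) (suc K) ≈ sumDec d (suc K) (frakTerm as ss)
  nest-partialSum []       []       K = partialAt1-one K
  nest-partialSum (s ∷ ss) (a ∷ as) K = Σₚ-cong (suc K) (nest-coeff s a ss as)

HasOrder : ℕ → PS → Set
HasOrder n f = ∀ j → j < n → f j ≡ + 0

HasOrder-≈ : ∀ {n f g} → f ≈ g → HasOrder n f → HasOrder n g
HasOrder-≈ f≈g ord j j<n = ≡.trans (≡.sym (coeff f≈g j)) (ord j j<n)

HasOrder-mono : ∀ {m n f} → m ≤ n → HasOrder n f → HasOrder m f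
HasOrder-mono m≤n ord j j<m = ord j (ℕP.<-≤-trans j<m m≤n)

HasOrder-qPow : ∀ k → HasOrder k (qPow k)
HasOrder-qPow k j j<k = qPow-ne k j (≢-sym (ℕP.<⇒≢ j<k))

HasOrder-* : ∀ {m n f g} → HasOrder m f → HasOrder n g → HasOrder (m ℕ.+ n) (f *ₚ g)
HasOrder-* {m} {n} {f} {g} ord-f ord-g j j<m+n = ≡.trans (Σ-cong (suc j) vanish) (Σ-zero (suc j))
  where
  vanish : ∀ i → i < suc j → f i ℤ.* g (j ℕ.∸ i) ≡ + 0
  vanish i (s≤s i≤j) with i ℕ.<? m
  ... | yes i<m = ≡.trans (cong (ℤ._* g (j ℕ.∸ i)) (ord-f i i<m)) (ℤP.*-zeroˡ (g (j ℕ.∸ i)))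
  ... | no i≮m = ≡.trans (cong (f i ℤ.*_) (ord-g (j ℕ.∸ i) j∸i<n)) (ℤP.*-zeroʳ (f i))
    where
    j∸i<n : j ℕ.∸ i < n
    j∸i<n = ℕP.+-cancelˡ-< i (j ℕ.∸ i) n
      (ℕP.<-≤-trans (subst (_< m ℕ.+ n) (≡.sym (ℕP.m+[n∸m]≡n i≤j)) j<m+n)
                    (ℕP.+-monoˡ-≤ n (ℕP.≮⇒≥ i≮m)))

HasOrder-Σ : ∀ {n} M (f : ℕ → PS) → (∀ i → i < M → HasOrder n (f i)) → HasOrder n (Σ<ₚ M f)
HasOrder-Σ M f ord j j<n = ≡.trans (Σ-cong M (λ i i<M → ord i i<M j j<n)) (Σ-zero M)

redistribute-weight : ∀ K k p a G S → k ≤ K →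
  (qPow (K ℕ.* p) *ₚ ((qPow (k ℕ.* a) *ₚ G) *ₚ S))
    ≈ ((G *ₚ qPow ((K ℕ.∸ k) ℕ.* p)) *ₚ (qPow (k ℕ.* (p ℕ.+ a)) *ₚ S))
redistribute-weight K k p a G S k≤K = begin
    qPow (K ℕ.* p) *ₚ ((qPow (k ℕ.* a) *ₚ G) *ₚ S)
  ≡⟨ cong (λ e → qPow e *ₚ ((qPow (k ℕ.* a) *ₚ G) *ₚ S)) Kp≡[K-k]p+kp ⟩
    qPow ((K ℕ.∸ k) ℕ.* p ℕ.+ k ℕ.* p) *ₚ ((qPow (k ℕ.* a) *ₚ G) *ₚ S)
  ≈⟨ *-congʳ {(qPow (k ℕ.* a) *ₚ G) *ₚ S} (≈-sym (qPow-+ ((K ℕ.∸ k) ℕ.* p) (k ℕ.* p))) ⟩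
    (qPow ((K ℕ.∸ k) ℕ.* p) *ₚ qPow (k ℕ.* p)) *ₚ ((qPow (k ℕ.* a) *ₚ G) *ₚ S)
  ≈⟨ regroup (qPow ((K ℕ.∸ k) ℕ.* p)) (qPow (k ℕ.* p)) (qPow (k ℕ.* a)) G S ⟩
    (G *ₚ qPow ((K ℕ.∸ k) ℕ.* p)) *ₚ ((qPow (k ℕ.* p) *ₚ qPow (k ℕ.* a)) *ₚ S)
  ≈⟨ *-congˡ {G *ₚ qPow ((K ℕ.∸ k) ℕ.* p)} (*-congʳ {S} (qPow-+ (k ℕ.* p) (k ℕ.* a))) ⟩
    (G *ₚ qPow ((K ℕ.∸ k) ℕ.* p)) *ₚ (qPow (k ℕ.* p ℕ.+ k ℕ.* a) *ₚ S)
  ≡⟨ cong (λ e → (G *ₚ qPow ((K ℕ.∸ k) ℕ.* p)) *ₚ (qPow e *ₚ S)) (≡.sym (ℕP.*-distribˡ-+ k p a)) ⟩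
    (G *ₚ qPow ((K ℕ.∸ k) ℕ.* p)) *ₚ (qPow (k ℕ.* (p ℕ.+ a)) *ₚ S)
  ∎
  where
  open ≈-Reasoning
  Kp≡[K-k]p+kp : K ℕ.* p ≡ (K ℕ.∸ k) ℕ.* p ℕ.+ k ℕ.* p
  Kp≡[K-k]p+kp = ≡.trans (cong (ℕ._* p) (≡.sym (ℕP.m∸n+n≡m k≤K))) (ℕP.*-distribʳ-+ p (K ℕ.∸ k) k)
  regroup : ∀ A B C G S → ((A *ₚ B) *ₚ ((C *ₚ G) *ₚ S)) ≈ ((G *ₚ A) *ₚ ((B *ₚ C) *ₚ S))
  regroup = ×-Solver.solve 5 (λ A B C G S → (A ⊕ B) ⊕ ((C ⊕ G) ⊕ S) ⊜ (G ⊕ A) ⊕ ((B ⊕ C) ⊕ S)) ≈-refl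

-- The tail estimate behind convergence: if p ≥ 1 and every p + a₁ + … + a_j ≥ 1,
-- then q^{Kp} times the truncated 𝔷-sum over K > k₁ > … > k_d > 0 has q-order ≥ K
-- (each summand carries q^{Kp + k₁a₁ + … + k_d a_d} with exponent ≥ K).
tail-order : ∀ {d} (ss as : Vec ℕ d) p K → 1 ≤ p → (∀ j → 1 ≤ p ℕ.+ prefixSum as j) →
             HasOrder K (qPow (K ℕ.* p) *ₚ sumDec d K (frakTerm as ss))
tail-order [] [] p K 1≤p = λ _ → HasOrder-≈ (≈-sym (*-identityʳ (qPow (K ℕ.* p))))
  (HasOrder-mono (ℕP.m≤m*n K p {{ℕ.>-nonZero 1≤p}}) (HasOrder-qPow (K ℕ.* p)))
tail-order {suc d} (s ∷ ss) (a ∷ as) p K 1≤p 1≤p+prefix =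
  HasOrder-≈ (Σₚ-linear K (qPow (K ℕ.* p)) (slice d F))
             (HasOrder-Σ K (λ k → qPow (K ℕ.* p) *ₚ slice d F k) weighted-slice)
  where
  F = frakTerm (a ∷ as) (s ∷ ss)
  weighted-slice : ∀ k → k < K → HasOrder K (qPow (K ℕ.* p) *ₚ slice d F k)
  weighted-slice zero    _   = HasOrder-≈ (≈-sym (zeroʳ (qPow (K ℕ.* p)))) (λ _ _ → ≡.refl)
  weighted-slice k@(suc _) k<K = HasOrder-≈ (≈-sym split)
    (HasOrder-mono K≤[K-k]p+k (HasOrder-* outer-weight inner-weight))
    where
    G = powₚ (geom k) s
    S = sumDec d k (frakTerm as ss)
    1≤p+a+prefix : ∀ j → 1 ≤ p ℕ.+ a ℕ.+ prefixSum as j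
    1≤p+a+prefix j = subst (1 ≤_) (≡.sym (ℕP.+-assoc p a (prefixSum as j))) (1≤p+prefix (suc j))
    outer-weight : HasOrder ((K ℕ.∸ k) ℕ.* p) (G *ₚ qPow ((K ℕ.∸ k) ℕ.* p))
    outer-weight = HasOrder-* {0} {f = G} (λ _ ()) (HasOrder-qPow ((K ℕ.∸ k) ℕ.* p))
    inner-weight : HasOrder k (qPow (k ℕ.* (p ℕ.+ a)) *ₚ S)
    inner-weight = tail-order ss as (p ℕ.+ a) k (ℕP.≤-trans 1≤p (ℕP.m≤m+n p a)) 1≤p+a+prefix
    split : (qPow (K ℕ.* p) *ₚ slice d F k)
              ≈ ((G *ₚ qPow ((K ℕ.∸ k) ℕ.* p)) *ₚ (qPow (k ℕ.* (p ℕ.+ a)) *ₚ S))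
    split = ≈-trans (*-congˡ {qPow (K ℕ.* p)} (sumDec-linear d k (qPow (k ℕ.* a) *ₚ G) (frakTerm as ss)))
                    (redistribute-weight K k p a G S (ℕP.<⇒≤ k<K))
    K≤[K-k]p+k : K ≤ (K ℕ.∸ k) ℕ.* p ℕ.+ k
    K≤[K-k]p+k = subst (_≤ (K ℕ.∸ k) ℕ.* p ℕ.+ k) (ℕP.m∸n+n≡m (ℕP.<⇒≤ k<K))
      (ℕP.+-monoˡ-≤ k (ℕP.m≤m*n (K ℕ.∸ k) p {{ℕ.>-nonZero 1≤p}}))

Stabilizes : (ℕ → PS) → Set
Stabilizes seq = ∀ j M → j < M → seq (suc M) j ≡ seq M j

stabilizes⇒converges : ∀ seq → Stabilizes seq → ConvergesTo seq (λ j → seq (suc j) j)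
stabilizes⇒converges seq stable j = suc j , settled
  where
  settled : ∀ M → suc j ≤ M → seq M j ≡ seq (suc j) j
  settled (suc M) j<1+M with ℕP.m≤n⇒m<n∨m≡n j<1+M
  ... | inj₁ (s≤s j<M) = ≡.trans (stable j M j<M) (settled M j<M)
  ... | inj₂ ≡.refl    = ≡.refl

ConvergesTo-≈ : ∀ {seq seq′ z} → (∀ M → seq M ≈ seq′ M) → ConvergesTo seq z → ConvergesTo seq′ z
ConvergesTo-≈ seq≈seq′ conv N with conv N
... | M , settled = M , λ M′ M≤M′ → ≡.trans (≡.sym (coeff (seq≈seq′ M′) N)) (settled M′ M≤M′)

converges-uniformly : ∀ {seq z} → ConvergesTo seq z →
  ∀ N → ∃[ M ] (∀ M′ → M ≤ M′ → ∀ i → i ≤ N → seq M′ i ≡ z i)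
converges-uniformly conv zero with conv 0
... | M , settled = M , λ { M′ M≤M′ .0 z≤n → settled M′ M≤M′ }
converges-uniformly {seq} {z} conv (suc N) with converges-uniformly conv N | conv (suc N)
... | M₁ , settled₁ | M₂ , settled₂ = M₁ ℕ.⊔ M₂ , settled
  where
  settled : ∀ M′ → M₁ ℕ.⊔ M₂ ≤ M′ → ∀ i → i ≤ suc N → seq M′ i ≡ z i
  settled M′ M≤M′ i i≤1+N with ℕP.m≤n⇒m<n∨m≡n i≤1+N
  ... | inj₁ (s≤s i≤N) = settled₁ M′ (ℕP.m⊔n≤o⇒m≤o M₁ M₂ M≤M′) i i≤N
  ... | inj₂ ≡.refl    = settled₂ M′ (ℕP.m⊔n≤o⇒n≤o M₁ M₂ M≤M′)

ConvergesTo-*ˡ : ∀ c {seq z} → ConvergesTo seq z → ConvergesTo (λ M → c *ₚ seq M) (c *ₚ z)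
ConvergesTo-*ˡ c {seq} {z} conv N with converges-uniformly conv N
... | M , settled = M , λ M′ M≤M′ → Σ-cong (suc N) (λ { i (s≤s i≤N) →
        cong (c i ℤ.*_) (settled M′ M≤M′ (N ℕ.∸ i) (ℕP.m∸n≤m N i)) })

-- When all prefix sums a₁ + … + a_j are positive, the truncated 𝔷-sums stabilize:
-- the new slice with k₁ = M has q-order ≥ M by the tail estimate.
frakSum-stabilizes : ∀ {d} (s a : Vec ℕ (suc d)) → (∀ j → 0 < prefixSum a j) →
                     Stabilizes (λ M → sumDec (suc d) M (frakTerm a s))
frakSum-stabilizes {d} (s ∷ ss) (a ∷ as) prefix>0 j M@(suc _) j<M =
  ≡.trans (cong (ℤ._+_ (sumDec (suc d) M F j)) (new-slice-vanishes j j<M))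
          (ℤP.+-identityʳ (sumDec (suc d) M F j))
  where
  F = frakTerm (a ∷ as) (s ∷ ss)
  G = powₚ (geom M) s
  S = sumDec d M (frakTerm as ss)
  rearranged : slice d F M ≈ (G *ₚ (qPow (M ℕ.* a) *ₚ S))
  rearranged = ≈-trans (sumDec-linear d M (qPow (M ℕ.* a) *ₚ G) (frakTerm as ss))
    (≈-trans (*-congʳ {S} (*-comm (qPow (M ℕ.* a)) G)) (*-assoc G (qPow (M ℕ.* a)) S))
  new-slice-vanishes : HasOrder M (slice d F M)
  new-slice-vanishes = HasOrder-≈ (≈-sym rearranged)
    (HasOrder-* {0} {f = G} (λ _ ()) (tail-order ss as a M (prefix>0 zero) (λ j → prefix>0 (suc j))))

-- ζ-summands versus 𝔷-summands: 1/[k]^s = (1 - q)^s/(1 - q^k)^s, hence the whole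
-- summand of ζ_q^t[s] is (1 - q)^{s₁+…+s_d} times that of 𝔷_q^t[s].
zetaTerm≈frakTerm : ∀ {d} (ts ss ks : Vec ℕ d) →
  zetaTerm ts ss ks ≈ (powₚ (oneMinusQPow 1) (sum ss) *ₚ frakTerm ts ss ks)
zetaTerm≈frakTerm [] [] [] = ≈-sym (*-identityˡ onePS)
zetaTerm≈frakTerm (t ∷ ts) (s ∷ ss) (k ∷ ks) = begin
    (Q *ₚ powₚ (O₁ *ₚ geom k) s) *ₚ zetaTerm ts ss ks
  ≈⟨ *-cong (*-congˡ {Q} (pow-* O₁ (geom k) s)) (zetaTerm≈frakTerm ts ss ks) ⟩
    (Q *ₚ (powₚ O₁ s *ₚ powₚ (geom k) s)) *ₚ (powₚ O₁ (sum ss) *ₚ frakTerm ts ss ks)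
  ≈⟨ regroup Q (powₚ O₁ s) (powₚ (geom k) s) (powₚ O₁ (sum ss)) (frakTerm ts ss ks) ⟩
    (powₚ O₁ s *ₚ powₚ O₁ (sum ss)) *ₚ ((Q *ₚ powₚ (geom k) s) *ₚ frakTerm ts ss ks)
  ≈⟨ *-congʳ {(Q *ₚ powₚ (geom k) s) *ₚ frakTerm ts ss ks} (≈-sym (pow-+ O₁ s (sum ss))) ⟩
    powₚ O₁ (s ℕ.+ sum ss) *ₚ ((Q *ₚ powₚ (geom k) s) *ₚ frakTerm ts ss ks)
  ∎
  where
  open ≈-Reasoning
  O₁ = oneMinusQPow 1
  Q = qPow (k ℕ.* t)
  regroup : ∀ Q A B C D → ((Q *ₚ (A *ₚ B)) *ₚ (C *ₚ D)) ≈ ((A *ₚ C) *ₚ ((Q *ₚ B) *ₚ D))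
  regroup = ×-Solver.solve 5 (λ Q A B C D → (Q ⊕ (A ⊕ B)) ⊕ (C ⊕ D) ⊜ (A ⊕ C) ⊕ ((Q ⊕ B) ⊕ D)) ≈-refl

zetaSum≈frakSum : ∀ d M (ts ss : Vec ℕ d) →
  sumDec d M (zetaTerm ts ss) ≈ (powₚ (oneMinusQPow 1) (sum ss) *ₚ sumDec d M (frakTerm ts ss))
zetaSum≈frakSum d M ts ss = ≈-trans (sumDec-cong d M (zetaTerm≈frakTerm ts ss))
  (sumDec-linear d M (powₚ (oneMinusQPow 1) (sum ss)) (frakTerm ts ss))

-- Theorem 6.2. The 𝔷-sums stabilize to a limit z; the partial sums of the nested
-- series at t = 1 are the same truncated sums, and the ζ-sums are (1 - q)^w times them.
theorem6p2 : (d : ℕ) (s a : Vec ℕ (suc d)) →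
  (∀ i → 1 ≤ lookup s i) →
  (∀ j → 0 < prefixSum a j) →
  Σ[ z ∈ PS ]
    ( ConvergesTo (partialAt1 (nest s a)) z
    × ConvergesTo (λ M → sumDec (suc d) M (zetaTerm a s))
                  (powₚ (oneMinusQPow 1) (sum s) *ₚ z)
    × ConvergesTo (λ M → sumDec (suc d) M (frakTerm a s)) z )
theorem6p2 d s@(s₁ ∷ ss) a@(a₁ ∷ as) _ prefix>0 =
  z , nest-converges , zeta-converges , frak-converges
  where
  frakSum : ℕ → PS
  frakSum M = sumDec (suc d) M (frakTerm a s)
  z : PS
  z j = frakSum (suc j) j
  frak-converges : ConvergesTo frakSum z
  frak-converges = stabilizes⇒converges frakSum (frakSum-stabilizes s a prefix>0)
  nest-converges : ConvergesTo (partialAt1 (nest s a)) z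
  nest-converges = ConvergesTo-≈ (λ M → ≈-sym (Σₚ-cong M (nest-coeff s₁ a₁ ss as))) frak-converges
  zeta-converges : ConvergesTo (λ M → sumDec (suc d) M (zetaTerm a s)) (powₚ (oneMinusQPow 1) (sum s) *ₚ z)
  zeta-converges = ConvergesTo-≈ (λ M → ≈-sym (zetaSum≈frakSum (suc d) M a s))
                                 (ConvergesTo-*ˡ (powₚ (oneMinusQPow 1) (sum s)) frak-converges)
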